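{- Let $\mathcal{B}$ be a cartesian bicategory satisfying the axiom of choice, and let $f\colon A\to B$, $g\colon A\to C$, $h\colon D\to B$, $k\colon D\to C$ be maps such that $f^{op};g\le h^{op};k$. Then there is a map $\omega\colon A\to D$ with $\omega;h=f$ and $\omega;k=g$.
   Context: Composition is diagrammatic ($R;S$ means first $R$ then $S$). A cartesian bicategory is a (strict) symmetric monoidal category $(\mathcal{B},\otimes,I)$ with symmetry $\sigma$, enriched over posets (hom-sets ordered by $\le$, with $;$ and $\otimes$ monotone), where every object $X$ has $\delta_X\colon X\to X\otimes X$, $\varepsilon_X\colon X\to I$ such that: (1) they form a cocommutative comonoid; (2) they have right adjoints $\delta_X^*,\varepsilon_X^*$: $\mathrm{id}_X\le\delta_X;\delta_X^*$, $\delta_X^*;\delta_X\le\mathrm{id}$, $\mathrm{id}_X\le\varepsilon_X;\varepsilon_X^*$, $\varepsilon_X^*;\varepsilon_X\le\mathrm{id}_I$; (3) $\delta_X^*;\delta_X=(\mathrm{id}_X\otimes\delta_X);(\delta_X^*\otimes\mathrm{id}_X)$; (4) every $R\colon X\to Y$ satisfies $R;\delta_Y\le\delta_X;(R\otimes R)$ and $R;\varepsilon_Y\le\varepsilon_X$; (5) $\varepsilon_{X\otimes Y}=\varepsilon_X\otimes\varepsilon_Y$, $\delta_{X\otimes Y}=(\delta_X\otimes\delta_Y);(\mathrm{id}\otimes\sigma_{X,Y}\otimes\mathrm{id})$, $\varepsilon_I=\delta_I=\mathrm{id}_I$. $R^{op}=(\mathrm{id}_Y\otimes(\varepsilon_X^*;\delta_X));(\mathrm{id}_Y\otimes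 R\otimes\mathrm{id}_X);((\delta_Y^*;\varepsilon_Y)\otimes\mathrm{id}_X)\colon Y\to X$ for $R\colon X\to Y$. $R$ is single valued if $\delta_X;(R\otimes R)\le R;\delta_Y$, total if $\varepsilon_X\le R;\varepsilon_Y$. A map is a single valued total morphism. Axiom of choice: for every total $R\colon X\to Y$ there is a map $f\colon X\to Y$ with $f\le R$. -}

module Defs where

open import Level using (Level; suc; _⊔_)
open import Relation.Binary.PropositionalEquality using (_≡_)
open import Relation.Binary.Structures using (IsPartialOrder)
open import Data.Product using (Σ; _×_)

-- Composition is diagrammatic: R ⨾ S means first R then S.
-- The symmetric monoidal structure is presented with explicit (coherent)
-- associator/unitors; a strict monoidal category is the instance in which
-- these are identities.
record CartesianBicategory (o ℓ e : Level) : Set (suc (o ⊔ ℓ ⊔ e)) where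
  infixl 30 _⨾_
  infixr 40 _⊗_ _⊗₀_
  infix 4 _≤_
  field
    Obj  : Set o
    Hom  : Obj → Obj → Set ℓ
    id   : ∀ {X} → Hom X X
    _⨾_  : ∀ {X Y Z} → Hom X Y → Hom Y Z → Hom X Z
    idˡ  : ∀ {X Y} (R : Hom X Y) → id ⨾ R ≡ R
    idʳ  : ∀ {X Y} (R : Hom X Y) → R ⨾ id ≡ R
    ⨾-assoc : ∀ {W X Y Z} (R : Hom W X) (S : Hom X Y) (T : Hom Y Z) →
              (R ⨾ S) ⨾ T ≡ R ⨾ (S ⨾ T)

    _≤_  : ∀ {X Y} → Hom X Y → Hom X Y → Set e
    ≤-isPartialOrder : ∀ {X Y} → IsPartialOrder (_≡_ {A = Hom X Y}) _≤_
    ⨾-mono : ∀ {X Y Z} {R R' : Hom X Y} {S S' : Hom Y Z} →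
             R ≤ R' → S ≤ S' → (R ⨾ S) ≤ (R' ⨾ S')

    I    : Obj
    _⊗₀_ : Obj → Obj → Obj
    _⊗_  : ∀ {X Y X' Y'} → Hom X Y → Hom X' Y' → Hom (X ⊗₀ X') (Y ⊗₀ Y')
    ⊗-id : ∀ {X Y} → id {X} ⊗ id {Y} ≡ id
    ⊗-⨾  : ∀ {X Y Z X' Y' Z'} (R : Hom X Y) (S : Hom Y Z)
             (R' : Hom X' Y') (S' : Hom Y' Z') →
           (R ⨾ S) ⊗ (R' ⨾ S') ≡ (R ⊗ R') ⨾ (S ⊗ S')
    ⊗-mono : ∀ {X Y X' Y'} {R S : Hom X Y} {R' S' : Hom X' Y'} →
             R ≤ S → R' ≤ S' → (R ⊗ R') ≤ (S ⊗ S')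

    α    : ∀ {X Y Z} → Hom ((X ⊗₀ Y) ⊗₀ Z) (X ⊗₀ (Y ⊗₀ Z))
    α⁻¹  : ∀ {X Y Z} → Hom (X ⊗₀ (Y ⊗₀ Z)) ((X ⊗₀ Y) ⊗₀ Z)
    α-iso₁ : ∀ {X Y Z} → α {X} {Y} {Z} ⨾ α⁻¹ ≡ id
    α-iso₂ : ∀ {X Y Z} → α⁻¹ {X} {Y} {Z} ⨾ α ≡ id
    α-nat  : ∀ {X Y Z X' Y' Z'} (R : Hom X X') (S : Hom Y Y') (T : Hom Z Z') →
             ((R ⊗ S) ⊗ T) ⨾ α ≡ α ⨾ (R ⊗ (S ⊗ T))

    λ⇒   : ∀ {X} → Hom (I ⊗₀ X) X
    λ⇐   : ∀ {X} → Hom X (I ⊗₀ X)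
    λ-iso₁ : ∀ {X} → λ⇒ {X} ⨾ λ⇐ ≡ id
    λ-iso₂ : ∀ {X} → λ⇐ {X} ⨾ λ⇒ ≡ id
    λ-nat  : ∀ {X Y} (R : Hom X Y) → (id ⊗ R) ⨾ λ⇒ ≡ λ⇒ ⨾ R

    ρ⇒   : ∀ {X} → Hom (X ⊗₀ I) X
    ρ⇐   : ∀ {X} → Hom X (X ⊗₀ I)
    ρ-iso₁ : ∀ {X} → ρ⇒ {X} ⨾ ρ⇐ ≡ id
    ρ-iso₂ : ∀ {X} → ρ⇐ {X} ⨾ ρ⇒ ≡ id
    ρ-nat  : ∀ {X Y} (R : Hom X Y) → (R ⊗ id) ⨾ ρ⇒ ≡ ρ⇒ ⨾ R

    pentagon : ∀ {W X Y Z} →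
      ((α {W} {X} {Y} ⊗ id {Z}) ⨾ α) ⨾ (id ⊗ α) ≡ α ⨾ α
    triangle : ∀ {X Y} → α {X} {I} {Y} ⨾ (id ⊗ λ⇒) ≡ ρ⇒ ⊗ id

    σ       : ∀ {X Y} → Hom (X ⊗₀ Y) (Y ⊗₀ X)
    σ-nat   : ∀ {X Y X' Y'} (R : Hom X X') (S : Hom Y Y') →
              (R ⊗ S) ⨾ σ ≡ σ ⨾ (S ⊗ R)
    σ-invol : ∀ {X Y} → σ {X} {Y} ⨾ σ ≡ id
    hexagon : ∀ {X Y Z} →
      (α {X} {Y} {Z} ⨾ σ) ⨾ α ≡ ((σ ⊗ id) ⨾ α) ⨾ (id ⊗ σ)

    δ  : ∀ {X} → Hom X (X ⊗₀ X)
    ε  : ∀ {X} → Hom X I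
    δ* : ∀ {X} → Hom (X ⊗₀ X) X
    ε* : ∀ {X} → Hom I X

    δ-coassoc : ∀ {X} → (δ {X} ⨾ (δ ⊗ id)) ⨾ α ≡ δ ⨾ (id ⊗ δ)
    δ-counitˡ : ∀ {X} → (δ {X} ⨾ (ε ⊗ id)) ⨾ λ⇒ ≡ id
    δ-counitʳ : ∀ {X} → (δ {X} ⨾ (id ⊗ ε)) ⨾ ρ⇒ ≡ id
    δ-cocomm  : ∀ {X} → δ {X} ⨾ σ ≡ δ

    δ-unit   : ∀ {X} → id ≤ (δ {X} ⨾ δ*)
    δ-counit : ∀ {X} → (δ* ⨾ δ {X}) ≤ id
    ε-unit   : ∀ {X} → id ≤ (ε {X} ⨾ ε*)
    ε-counit : ∀ {X} → (ε* ⨾ ε {X}) ≤ id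

    frobenius : ∀ {X} → δ* ⨾ δ {X} ≡ ((id ⊗ δ) ⨾ α⁻¹) ⨾ (δ* ⊗ id)

    δ-lax : ∀ {X Y} (R : Hom X Y) → (R ⨾ δ) ≤ (δ ⨾ (R ⊗ R))
    ε-lax : ∀ {X Y} (R : Hom X Y) → (R ⨾ ε) ≤ ε

    ε-⊗ : ∀ {X Y} → ε {X ⊗₀ Y} ≡ (ε ⊗ ε) ⨾ λ⇒
    δ-⊗ : ∀ {X Y} → δ {X ⊗₀ Y} ≡
      (δ ⊗ δ) ⨾ α ⨾ (id ⊗ α⁻¹) ⨾ (id ⊗ (σ ⊗ id)) ⨾ (id ⊗ α) ⨾ α⁻¹
    ε-I : ε {I} ≡ id
    δ-I : δ {I} ≡ λ⇐

  _ᵒᵖ : ∀ {X Y} → Hom X Y → Hom Y X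
  R ᵒᵖ = ρ⇐ ⨾ (id ⊗ (ε* ⨾ δ)) ⨾ α⁻¹ ⨾ ((id ⊗ R) ⊗ id) ⨾ ((δ* ⨾ ε) ⊗ id) ⨾ λ⇒

  SingleValued : ∀ {X Y} → Hom X Y → Set e
  SingleValued R = (δ ⨾ (R ⊗ R)) ≤ (R ⨾ δ)

  Total : ∀ {X Y} → Hom X Y → Set e
  Total R = ε ≤ (R ⨾ ε)

  IsMap : ∀ {X Y} → Hom X Y → Set e
  IsMap R = SingleValued R × Total R

  AxiomOfChoice : Set (o ⊔ ℓ ⊔ e)
  AxiomOfChoice = ∀ {X Y} (R : Hom X Y) → Total R →
                  Σ (Hom X Y) (λ f → IsMap f × (f ≤ R))

-- Put Y = f ⨾ hᵒᵖ. As f is total, g ≤ f ⨾ fᵒᵖ ⨾ g ≤ Y ⨾ k, so the relation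
-- R = {(a , d) | d ∈ Y a, k d = g a} is total: R ⨾ k = g ∩ (Y ⨾ k) contains g.
-- Choice gives a map ω ≤ R, and then ω ⨾ k ≤ g and ω ⨾ h ≤ f ⨾ hᵒᵖ ⨾ h ≤ f.
-- A total T below a single-valued S equals it, because
-- S ≤ T ⨾ Tᵒᵖ ⨾ S ≤ T ⨾ Sᵒᵖ ⨾ S ≤ T; the two inequalities id ≤ T ⨾ Tᵒᵖ (T total)
-- and Sᵒᵖ ⨾ S ≤ id (S single valued) come from the snake equation for the
-- cup ε* ⨾ δ and the cap δ* ⨾ ε, which is where the Frobenius law enters.
module Submission where

open import Defs
open import Level using (Level)
open import Relation.Binary.PropositionalEquality using (_≡_; sym; trans; cong; cong₂)
open import Relation.Binary.Bundles using (Poset)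
import Relation.Binary.Reasoning.PartialOrder as PosetReasoning
open import Data.Product using (Σ; _×_; _,_)

module CartesianBicategoryProperties {o ℓ e : Level} (𝓑 : CartesianBicategory o ℓ e) where
  open CartesianBicategory 𝓑

  homPoset : Obj → Obj → Poset ℓ ℓ e
  homPoset X Y = record { isPartialOrder = ≤-isPartialOrder {X} {Y} }

  module _ {X Y : Obj} where
    open Poset (homPoset X Y) public
      using (≤-respʳ-≈) renaming (refl to ≤-refl; trans to ≤-trans; antisym to ≤-antisym)
    open PosetReasoning (homPoset X Y) public

  ⨾-monoˡ-≤ : ∀ {X Y Z} {R S : Hom X Y} {T : Hom Y Z} → R ≤ S → R ⨾ T ≤ S ⨾ T
  ⨾-monoˡ-≤ p = ⨾-mono p ≤-refl

  ⨾-monoʳ-≤ : ∀ {X Y Z} {T : Hom X Y} {R S : Hom Y Z} → R ≤ S → T ⨾ R ≤ T ⨾ S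
  ⨾-monoʳ-≤ p = ⨾-mono ≤-refl p

  assoc : ∀ {W X Y Z} {R : Hom W X} {S : Hom X Y} {T : Hom Y Z} → (R ⨾ S) ⨾ T ≡ R ⨾ (S ⨾ T)
  assoc = ⨾-assoc _ _ _

  sym-assoc : ∀ {W X Y Z} {R : Hom W X} {S : Hom X Y} {T : Hom Y Z} → R ⨾ (S ⨾ T) ≡ (R ⨾ S) ⨾ T
  sym-assoc = sym assoc

  interchange : ∀ {X Y Z X' Y' Z'} {R : Hom X Y} {S : Hom Y Z} {R' : Hom X' Y'} {S' : Hom Y' Z'} →
                (R ⊗ R') ⨾ (S ⊗ S') ≡ (R ⨾ S) ⊗ (R' ⨾ S')
  interchange = sym (⊗-⨾ _ _ _ _)

  ⊗-split₁ : ∀ {X Y X' Y'} (R : Hom X Y) (S : Hom X' Y') → R ⊗ S ≡ (R ⊗ id) ⨾ (id ⊗ S)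
  ⊗-split₁ R S = trans (sym (cong₂ _⊗_ (idʳ R) (idˡ S))) (⊗-⨾ _ _ _ _)

  ⊗-split₂ : ∀ {X Y X' Y'} (R : Hom X Y) (S : Hom X' Y') → R ⊗ S ≡ (id ⊗ S) ⨾ (R ⊗ id)
  ⊗-split₂ R S = trans (sym (cong₂ _⊗_ (idˡ R) (idʳ S))) (⊗-⨾ _ _ _ _)

  ⊗id-⨾-id⊗-comm : ∀ {X Y X' Y'} (R : Hom X Y) (S : Hom X' Y') →
                   (R ⊗ id) ⨾ (id ⊗ S) ≡ (id ⊗ S) ⨾ (R ⊗ id)
  ⊗id-⨾-id⊗-comm R S = trans (sym (⊗-split₁ R S)) (⊗-split₂ R S)

  ⨾-⊗id : ∀ {X Y Z W} (R : Hom X Y) (S : Hom Y Z) → (R ⨾ S) ⊗ id {W} ≡ (R ⊗ id) ⨾ (S ⊗ id)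
  ⨾-⊗id R S = trans (cong ((R ⨾ S) ⊗_) (sym (idˡ id))) (⊗-⨾ _ _ _ _)

  id⊗-⨾ : ∀ {X Y Z W} (R : Hom X Y) (S : Hom Y Z) → id {W} ⊗ (R ⨾ S) ≡ (id ⊗ R) ⨾ (id ⊗ S)
  id⊗-⨾ R S = trans (cong (_⊗ (R ⨾ S)) (sym (idˡ id))) (⊗-⨾ _ _ _ _)

  α⁻¹-nat : ∀ {X Y Z X' Y' Z'} (R : Hom X X') (S : Hom Y Y') (T : Hom Z Z') →
            α⁻¹ ⨾ ((R ⊗ S) ⊗ T) ≡ (R ⊗ (S ⊗ T)) ⨾ α⁻¹
  α⁻¹-nat R S T = begin-equality
    α⁻¹ ⨾ ((R ⊗ S) ⊗ T)                   ≡⟨ idʳ _ ⟨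
    α⁻¹ ⨾ ((R ⊗ S) ⊗ T) ⨾ id              ≡⟨ cong (α⁻¹ ⨾ ((R ⊗ S) ⊗ T) ⨾_) α-iso₁ ⟨
    α⁻¹ ⨾ ((R ⊗ S) ⊗ T) ⨾ (α ⨾ α⁻¹)       ≡⟨ trans sym-assoc (cong (_⨾ α⁻¹) assoc) ⟩
    α⁻¹ ⨾ (((R ⊗ S) ⊗ T) ⨾ α) ⨾ α⁻¹       ≡⟨ cong (λ x → α⁻¹ ⨾ x ⨾ α⁻¹) (α-nat R S T) ⟩
    α⁻¹ ⨾ (α ⨾ (R ⊗ (S ⊗ T))) ⨾ α⁻¹       ≡⟨ cong (_⨾ α⁻¹) sym-assoc ⟩
    α⁻¹ ⨾ α ⨾ (R ⊗ (S ⊗ T)) ⨾ α⁻¹         ≡⟨ cong (λ x → x ⨾ (R ⊗ (S ⊗ T)) ⨾ α⁻¹) α-iso₂ ⟩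
    id ⨾ (R ⊗ (S ⊗ T)) ⨾ α⁻¹              ≡⟨ cong (_⨾ α⁻¹) (idˡ _) ⟩
    (R ⊗ (S ⊗ T)) ⨾ α⁻¹                   ∎

  ρ⇐-nat : ∀ {X Y} (R : Hom X Y) → ρ⇐ ⨾ (R ⊗ id) ≡ R ⨾ ρ⇐
  ρ⇐-nat R = begin-equality
    ρ⇐ ⨾ (R ⊗ id)                ≡⟨ idʳ _ ⟨
    ρ⇐ ⨾ (R ⊗ id) ⨾ id           ≡⟨ cong (ρ⇐ ⨾ (R ⊗ id) ⨾_) ρ-iso₁ ⟨
    ρ⇐ ⨾ (R ⊗ id) ⨾ (ρ⇒ ⨾ ρ⇐)    ≡⟨ trans sym-assoc (cong (_⨾ ρ⇐) assoc) ⟩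
    ρ⇐ ⨾ ((R ⊗ id) ⨾ ρ⇒) ⨾ ρ⇐    ≡⟨ cong (λ x → ρ⇐ ⨾ x ⨾ ρ⇐) (ρ-nat R) ⟩
    ρ⇐ ⨾ (ρ⇒ ⨾ R) ⨾ ρ⇐           ≡⟨ cong (_⨾ ρ⇐) sym-assoc ⟩
    ρ⇐ ⨾ ρ⇒ ⨾ R ⨾ ρ⇐             ≡⟨ cong (λ x → x ⨾ R ⨾ ρ⇐) ρ-iso₂ ⟩
    id ⨾ R ⨾ ρ⇐                  ≡⟨ cong (_⨾ ρ⇐) (idˡ _) ⟩
    R ⨾ ρ⇐                       ∎

  α⁻¹⨾ρ⇒⊗id : ∀ {X Y} → α⁻¹ ⨾ (ρ⇒ ⊗ id) ≡ id {X} ⊗ λ⇒ {Y}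
  α⁻¹⨾ρ⇒⊗id = begin-equality
    α⁻¹ ⨾ (ρ⇒ ⊗ id)             ≡⟨ cong (α⁻¹ ⨾_) triangle ⟨
    α⁻¹ ⨾ (α ⨾ (id ⊗ λ⇒))       ≡⟨ trans sym-assoc (cong (_⨾ (id ⊗ λ⇒)) α-iso₂) ⟩
    id ⨾ (id ⊗ λ⇒)              ≡⟨ idˡ _ ⟩
    id ⊗ λ⇒                     ∎

  total⇒⨾ε≡ε : ∀ {X Y} {R : Hom X Y} → Total R → R ⨾ ε ≡ ε
  total⇒⨾ε≡ε t = ≤-antisym (ε-lax _) t

  singleValued⇒⨾δ≡δ⨾⊗ : ∀ {X Y} {R : Hom X Y} → SingleValued R → R ⨾ δ ≡ δ ⨾ (R ⊗ R)
  singleValued⇒⨾δ≡δ⨾⊗ s = ≤-antisym (δ-lax _) s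

  ⨾-total : ∀ {X Y Z} {R : Hom X Y} {S : Hom Y Z} → Total R → Total S → Total (R ⨾ S)
  ⨾-total {R = R} {S} tR tS = begin
    ε             ≤⟨ tR ⟩
    R ⨾ ε         ≡⟨ cong (R ⨾_) (total⇒⨾ε≡ε tS) ⟨
    R ⨾ (S ⨾ ε)   ≡⟨ sym-assoc ⟩
    R ⨾ S ⨾ ε     ∎

  π₁ : ∀ {X Y} → Hom (X ⊗₀ Y) X
  π₁ = (id ⊗ ε) ⨾ ρ⇒

  π₂ : ∀ {X Y} → Hom (X ⊗₀ Y) Y
  π₂ = (ε ⊗ id) ⨾ λ⇒

  δ⨾π₁≡id : ∀ {X} → δ ⨾ π₁ ≡ id {X}
  δ⨾π₁≡id = trans sym-assoc δ-counitʳ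

  δ⨾π₂≡id : ∀ {X} → δ ⨾ π₂ ≡ id {X}
  δ⨾π₂≡id = trans sym-assoc δ-counitˡ

  π₁-lax : ∀ {X Y X' Y'} (U : Hom X Y) (V : Hom X' Y') → (U ⊗ V) ⨾ π₁ ≤ π₁ ⨾ U
  π₁-lax U V = begin
    (U ⊗ V) ⨾ ((id ⊗ ε) ⨾ ρ⇒)    ≡⟨ trans sym-assoc (cong (_⨾ ρ⇒) interchange) ⟩
    ((U ⨾ id) ⊗ (V ⨾ ε)) ⨾ ρ⇒    ≤⟨ ⨾-monoˡ-≤ (⊗-mono ≤-refl (ε-lax V)) ⟩
    ((U ⨾ id) ⊗ ε) ⨾ ρ⇒          ≡⟨ cong (_⨾ ρ⇒) (trans (cong (_⊗ ε) (idʳ U)) (⊗-split₂ U ε)) ⟩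
    (id ⊗ ε) ⨾ (U ⊗ id) ⨾ ρ⇒     ≡⟨ trans assoc (cong ((id ⊗ ε) ⨾_) (ρ-nat U)) ⟩
    (id ⊗ ε) ⨾ (ρ⇒ ⨾ U)          ≡⟨ sym-assoc ⟩
    π₁ ⨾ U                       ∎

  π₂-lax : ∀ {X Y X' Y'} (U : Hom X Y) (V : Hom X' Y') → (U ⊗ V) ⨾ π₂ ≤ π₂ ⨾ V
  π₂-lax U V = begin
    (U ⊗ V) ⨾ ((ε ⊗ id) ⨾ λ⇒)    ≡⟨ trans sym-assoc (cong (_⨾ λ⇒) interchange) ⟩
    ((U ⨾ ε) ⊗ (V ⨾ id)) ⨾ λ⇒    ≤⟨ ⨾-monoˡ-≤ (⊗-mono (ε-lax U) ≤-refl) ⟩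
    (ε ⊗ (V ⨾ id)) ⨾ λ⇒          ≡⟨ cong (_⨾ λ⇒) (trans (cong (ε ⊗_) (idʳ V)) (⊗-split₁ ε V)) ⟩
    (ε ⊗ id) ⨾ (id ⊗ V) ⨾ λ⇒     ≡⟨ trans assoc (cong ((ε ⊗ id) ⨾_) (λ-nat V)) ⟩
    (ε ⊗ id) ⨾ (λ⇒ ⨾ V)          ≡⟨ sym-assoc ⟩
    π₂ ⨾ V                       ∎

  δ*≤π₁ : ∀ {X} → δ* {X} ≤ π₁
  δ*≤π₁ = begin
    δ*               ≡⟨ idʳ _ ⟨
    δ* ⨾ id          ≡⟨ cong (δ* ⨾_) δ⨾π₁≡id ⟨
    δ* ⨾ (δ ⨾ π₁)    ≡⟨ sym-assoc ⟩
    δ* ⨾ δ ⨾ π₁      ≤⟨ ⨾-monoˡ-≤ δ-counit ⟩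
    id ⨾ π₁          ≡⟨ idˡ _ ⟩
    π₁               ∎

  infixl 35 _∩_
  _∩_ : ∀ {X Y} → Hom X Y → Hom X Y → Hom X Y
  U ∩ V = δ ⨾ (U ⊗ V) ⨾ δ*

  ∩-lowerˡ : ∀ {X Y} (U V : Hom X Y) → U ∩ V ≤ U
  ∩-lowerˡ U V = begin
    δ ⨾ (U ⊗ V) ⨾ δ*      ≤⟨ ⨾-monoʳ-≤ δ*≤π₁ ⟩
    δ ⨾ (U ⊗ V) ⨾ π₁      ≡⟨ assoc ⟩
    δ ⨾ ((U ⊗ V) ⨾ π₁)    ≤⟨ ⨾-monoʳ-≤ (π₁-lax U V) ⟩
    δ ⨾ (π₁ ⨾ U)          ≡⟨ trans sym-assoc (cong (_⨾ U) δ⨾π₁≡id) ⟩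
    id ⨾ U                ≡⟨ idˡ U ⟩
    U                     ∎

  ≤-∩-self : ∀ {X Y} (U : Hom X Y) → U ≤ U ∩ U
  ≤-∩-self U = begin
    U                  ≡⟨ idʳ U ⟨
    U ⨾ id             ≤⟨ ⨾-monoʳ-≤ δ-unit ⟩
    U ⨾ (δ ⨾ δ*)       ≡⟨ sym-assoc ⟩
    U ⨾ δ ⨾ δ*         ≤⟨ ⨾-monoˡ-≤ (δ-lax U) ⟩
    δ ⨾ (U ⊗ U) ⨾ δ*   ∎

  ∩-monoʳ : ∀ {X Y} (U : Hom X Y) {V V' : Hom X Y} → V ≤ V' → U ∩ V ≤ U ∩ V'
  ∩-monoʳ U p = ⨾-monoˡ-≤ (⨾-monoʳ-≤ (⊗-mono ≤-refl p))

  cup : ∀ {X} → Hom I (X ⊗₀ X)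
  cup = ε* ⨾ δ

  cap : ∀ {X} → Hom (X ⊗₀ X) I
  cap = δ* ⨾ ε

  cap≤ε⊗ε : ∀ {X} → cap {X} ≤ (ε ⊗ ε) ⨾ ρ⇒
  cap≤ε⊗ε = begin
    δ* ⨾ ε                       ≤⟨ ⨾-monoˡ-≤ δ*≤π₁ ⟩
    (id ⊗ ε) ⨾ ρ⇒ ⨾ ε            ≡⟨ trans (cong ((id ⊗ ε) ⨾_) (ρ-nat ε)) sym-assoc ⟨
    (id ⊗ ε) ⨾ ((ε ⊗ id) ⨾ ρ⇒)   ≡⟨ trans (cong (_⨾ ρ⇒) (⊗-split₂ ε ε)) assoc ⟨
    (ε ⊗ ε) ⨾ ρ⇒                 ∎

  cupʳ : ∀ Y X → Hom Y ((Y ⊗₀ X) ⊗₀ X)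
  cupʳ Y X = ρ⇐ ⨾ (id ⊗ cup) ⨾ α⁻¹

  capˡ : ∀ Y X → Hom ((Y ⊗₀ Y) ⊗₀ X) X
  capˡ Y X = (cap ⊗ id) ⨾ λ⇒

  ᵒᵖ-unfold : ∀ {X Y} (R : Hom X Y) → (R ᵒᵖ) ≡ cupʳ Y X ⨾ ((id ⊗ R) ⊗ id) ⨾ capˡ Y X
  ᵒᵖ-unfold R = assoc

  δ*-unitʳ : ∀ {X} → ρ⇐ ⨾ (id ⊗ ε*) ⨾ δ* ≡ id {X}
  δ*-unitʳ = ≤-antisym lower upper
    where
    lower : ρ⇐ ⨾ (id ⊗ ε*) ⨾ δ* ≤ id
    lower = begin
      ρ⇐ ⨾ (id ⊗ ε*) ⨾ δ*                 ≤⟨ ⨾-monoʳ-≤ δ*≤π₁ ⟩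
      ρ⇐ ⨾ (id ⊗ ε*) ⨾ ((id ⊗ ε) ⨾ ρ⇒)    ≡⟨ trans sym-assoc (cong (_⨾ ρ⇒) assoc) ⟩
      ρ⇐ ⨾ ((id ⊗ ε*) ⨾ (id ⊗ ε)) ⨾ ρ⇒    ≡⟨ cong (λ x → ρ⇐ ⨾ x ⨾ ρ⇒) (id⊗-⨾ ε* ε) ⟨
      ρ⇐ ⨾ (id ⊗ (ε* ⨾ ε)) ⨾ ρ⇒           ≤⟨ ⨾-monoˡ-≤ (⨾-monoʳ-≤ (⊗-mono ≤-refl ε-counit)) ⟩
      ρ⇐ ⨾ (id ⊗ id) ⨾ ρ⇒                 ≡⟨ cong (λ x → ρ⇐ ⨾ x ⨾ ρ⇒) ⊗-id ⟩
      ρ⇐ ⨾ id ⨾ ρ⇒                        ≡⟨ trans (cong (_⨾ ρ⇒) (idʳ _)) ρ-iso₂ ⟩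
      id                                  ∎
    split : (id ⊗ ε) ⨾ (id ⊗ ε*) ≡ π₁ ⨾ (ρ⇐ ⨾ (id ⊗ ε*))
    split = begin-equality
      (id ⊗ ε) ⨾ (id ⊗ ε*)               ≡⟨ cong ((id ⊗ ε) ⨾_) (idˡ _) ⟨
      (id ⊗ ε) ⨾ (id ⨾ (id ⊗ ε*))        ≡⟨ cong (λ x → (id ⊗ ε) ⨾ (x ⨾ (id ⊗ ε*))) ρ-iso₁ ⟨
      (id ⊗ ε) ⨾ (ρ⇒ ⨾ ρ⇐ ⨾ (id ⊗ ε*))    ≡⟨ trans (cong ((id ⊗ ε) ⨾_) assoc) sym-assoc ⟩
      π₁ ⨾ (ρ⇐ ⨾ (id ⊗ ε*))              ∎
    upper : id ≤ ρ⇐ ⨾ (id ⊗ ε*) ⨾ δ*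
    upper = begin
      id                                  ≤⟨ δ-unit ⟩
      δ ⨾ δ*                              ≡⟨ cong (_⨾ δ*) (idʳ δ) ⟨
      δ ⨾ id ⨾ δ*                         ≡⟨ cong (λ x → δ ⨾ x ⨾ δ*) ⊗-id ⟨
      δ ⨾ (id ⊗ id) ⨾ δ*                  ≤⟨ ⨾-monoˡ-≤ (⨾-monoʳ-≤ (⊗-mono ≤-refl ε-unit)) ⟩
      δ ⨾ (id ⊗ (ε ⨾ ε*)) ⨾ δ*            ≡⟨ cong (λ x → δ ⨾ x ⨾ δ*) (trans (id⊗-⨾ ε ε*) split) ⟩
      δ ⨾ (π₁ ⨾ (ρ⇐ ⨾ (id ⊗ ε*))) ⨾ δ*    ≡⟨ trans (cong (_⨾ δ*) sym-assoc) assoc ⟩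
      δ ⨾ π₁ ⨾ (ρ⇐ ⨾ (id ⊗ ε*) ⨾ δ*)      ≡⟨ trans (cong (_⨾ (ρ⇐ ⨾ (id ⊗ ε*) ⨾ δ*)) δ⨾π₁≡id) (idˡ _) ⟩
      ρ⇐ ⨾ (id ⊗ ε*) ⨾ δ*                 ∎

  capˡ-frobenius : ∀ {X} → (id ⊗ δ) ⨾ α⁻¹ ⨾ capˡ X X ≡ δ*
  capˡ-frobenius = begin-equality
    (id ⊗ δ) ⨾ α⁻¹ ⨾ ((cap ⊗ id) ⨾ λ⇒)               ≡⟨ cong (λ x → (id ⊗ δ) ⨾ α⁻¹ ⨾ (x ⨾ λ⇒)) (⨾-⊗id δ* ε) ⟩
    (id ⊗ δ) ⨾ α⁻¹ ⨾ ((δ* ⊗ id) ⨾ (ε ⊗ id) ⨾ λ⇒)     ≡⟨ trans (cong ((id ⊗ δ) ⨾ α⁻¹ ⨾_) assoc) sym-assoc ⟩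
    (id ⊗ δ) ⨾ α⁻¹ ⨾ (δ* ⊗ id) ⨾ π₂                  ≡⟨ cong (_⨾ π₂) frobenius ⟨
    δ* ⨾ δ ⨾ π₂                                      ≡⟨ trans assoc (cong (δ* ⨾_) δ⨾π₂≡id) ⟩
    δ* ⨾ id                                          ≡⟨ idʳ _ ⟩
    δ*                                               ∎

  snake : ∀ {X} → cupʳ X X ⨾ capˡ X X ≡ id
  snake = begin-equality
    ρ⇐ ⨾ (id ⊗ (ε* ⨾ δ)) ⨾ α⁻¹ ⨾ capˡ _ _                ≡⟨ cong (λ x → ρ⇐ ⨾ x ⨾ α⁻¹ ⨾ capˡ _ _) (id⊗-⨾ ε* δ) ⟩
    ρ⇐ ⨾ ((id ⊗ ε*) ⨾ (id ⊗ δ)) ⨾ α⁻¹ ⨾ capˡ _ _         ≡⟨ cong (λ x → x ⨾ α⁻¹ ⨾ capˡ _ _) sym-assoc ⟩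
    ρ⇐ ⨾ (id ⊗ ε*) ⨾ (id ⊗ δ) ⨾ α⁻¹ ⨾ capˡ _ _           ≡⟨ trans (cong (_⨾ capˡ _ _) assoc) assoc ⟩
    ρ⇐ ⨾ (id ⊗ ε*) ⨾ ((id ⊗ δ) ⨾ α⁻¹ ⨾ capˡ _ _)         ≡⟨ cong (ρ⇐ ⨾ (id ⊗ ε*) ⨾_) capˡ-frobenius ⟩
    ρ⇐ ⨾ (id ⊗ ε*) ⨾ δ*                                  ≡⟨ δ*-unitʳ ⟩
    id                                                   ∎

  cupʳ-nat : ∀ {X Y Z} (R : Hom X Y) → cupʳ X Z ⨾ ((R ⊗ id) ⊗ id) ≡ R ⨾ cupʳ Y Z
  cupʳ-nat R = begin-equality
    ρ⇐ ⨾ (id ⊗ cup) ⨾ α⁻¹ ⨾ ((R ⊗ id) ⊗ id)      ≡⟨ trans assoc (cong (ρ⇐ ⨾ (id ⊗ cup) ⨾_) (α⁻¹-nat R id id)) ⟩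
    ρ⇐ ⨾ (id ⊗ cup) ⨾ ((R ⊗ (id ⊗ id)) ⨾ α⁻¹)    ≡⟨ cong (λ x → ρ⇐ ⨾ (id ⊗ cup) ⨾ ((R ⊗ x) ⨾ α⁻¹)) ⊗-id ⟩
    ρ⇐ ⨾ (id ⊗ cup) ⨾ ((R ⊗ id) ⨾ α⁻¹)           ≡⟨ trans sym-assoc (cong (_⨾ α⁻¹) assoc) ⟩
    ρ⇐ ⨾ ((id ⊗ cup) ⨾ (R ⊗ id)) ⨾ α⁻¹           ≡⟨ cong (λ x → ρ⇐ ⨾ x ⨾ α⁻¹) (⊗id-⨾-id⊗-comm R cup) ⟨
    ρ⇐ ⨾ ((R ⊗ id) ⨾ (id ⊗ cup)) ⨾ α⁻¹           ≡⟨ cong (_⨾ α⁻¹) sym-assoc ⟩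
    ρ⇐ ⨾ (R ⊗ id) ⨾ (id ⊗ cup) ⨾ α⁻¹             ≡⟨ cong (λ x → x ⨾ (id ⊗ cup) ⨾ α⁻¹) (ρ⇐-nat R) ⟩
    R ⨾ ρ⇐ ⨾ (id ⊗ cup) ⨾ α⁻¹                    ≡⟨ trans (cong (_⨾ α⁻¹) assoc) assoc ⟩
    R ⨾ cupʳ _ _                                 ∎

  capˡ-nat : ∀ {X Y Z} (R : Hom X Y) → capˡ Z X ⨾ R ≡ (id ⊗ R) ⨾ capˡ Z Y
  capˡ-nat R = begin-equality
    (cap ⊗ id) ⨾ λ⇒ ⨾ R              ≡⟨ trans (cong ((cap ⊗ id) ⨾_) (λ-nat R)) sym-assoc ⟨
    (cap ⊗ id) ⨾ ((id ⊗ R) ⨾ λ⇒)     ≡⟨ trans sym-assoc (cong (_⨾ λ⇒) (⊗id-⨾-id⊗-comm cap R)) ⟩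
    (id ⊗ R) ⨾ (cap ⊗ id) ⨾ λ⇒       ≡⟨ assoc ⟩
    (id ⊗ R) ⨾ capˡ _ _              ∎

  ε*-⨾-≤ : ∀ {X Y} (R : Hom X Y) → ε* ⨾ R ≤ ε*
  ε*-⨾-≤ R = begin
    ε* ⨾ R                ≡⟨ idʳ _ ⟨
    ε* ⨾ R ⨾ id           ≤⟨ ⨾-monoʳ-≤ ε-unit ⟩
    ε* ⨾ R ⨾ (ε ⨾ ε*)     ≡⟨ trans sym-assoc (cong (_⨾ ε*) assoc) ⟩
    ε* ⨾ (R ⨾ ε) ⨾ ε*     ≤⟨ ⨾-monoˡ-≤ (⨾-monoʳ-≤ (ε-lax R)) ⟩
    ε* ⨾ ε ⨾ ε*           ≤⟨ ⨾-monoˡ-≤ ε-counit ⟩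
    id ⨾ ε*               ≡⟨ idˡ _ ⟩
    ε*                    ∎

  singleValued⇒cup⨾⊗≤cup : ∀ {X Y} {R : Hom X Y} → SingleValued R → cup ⨾ (R ⊗ R) ≤ cup
  singleValued⇒cup⨾⊗≤cup {R = R} s = begin
    ε* ⨾ δ ⨾ (R ⊗ R)      ≡⟨ assoc ⟩
    ε* ⨾ (δ ⨾ (R ⊗ R))    ≤⟨ ⨾-monoʳ-≤ s ⟩
    ε* ⨾ (R ⨾ δ)          ≡⟨ sym-assoc ⟩
    ε* ⨾ R ⨾ δ            ≤⟨ ⨾-monoˡ-≤ (ε*-⨾-≤ R) ⟩
    ε* ⨾ δ                ∎

  total⇒cap≤⊗⨾cap : ∀ {X Y} {R : Hom X Y} → Total R → cap ≤ (R ⊗ R) ⨾ cap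
  total⇒cap≤⊗⨾cap {R = R} t = begin
    δ* ⨾ ε                        ≤⟨ ⨾-monoʳ-≤ t ⟩
    δ* ⨾ (R ⨾ ε)                  ≤⟨ ⨾-monoʳ-≤ (⨾-monoˡ-≤ (≤-∩-self R)) ⟩
    δ* ⨾ (δ ⨾ (R ⊗ R) ⨾ δ* ⨾ ε)    ≡⟨ trans (cong (δ* ⨾_) (trans assoc assoc)) sym-assoc ⟩
    δ* ⨾ δ ⨾ ((R ⊗ R) ⨾ cap)       ≤⟨ ⨾-monoˡ-≤ δ-counit ⟩
    id ⨾ ((R ⊗ R) ⨾ cap)           ≡⟨ idˡ _ ⟩
    (R ⊗ R) ⨾ cap                  ∎

  ᵒᵖ-mono : ∀ {X Y} {R S : Hom X Y} → R ≤ S → (R ᵒᵖ) ≤ (S ᵒᵖ)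
  ᵒᵖ-mono p = ⨾-monoˡ-≤ (⨾-monoˡ-≤ (⨾-monoʳ-≤ (⊗-mono (⊗-mono ≤-refl p) ≤-refl)))

  total⇒id≤⨾ᵒᵖ : ∀ {X Y} {R : Hom X Y} → Total R → id ≤ R ⨾ (R ᵒᵖ)
  total⇒id≤⨾ᵒᵖ {X} {Y} {R} t = begin
    id                                                              ≡⟨ snake ⟨
    cupʳ X X ⨾ capˡ X X                                             ≤⟨ ⨾-monoʳ-≤ capˡ≤ ⟩
    cupʳ X X ⨾ (((R ⊗ id) ⊗ id) ⨾ (((id ⊗ R) ⊗ id) ⨾ capˡ Y X))    ≡⟨ sym-assoc ⟩
    cupʳ X X ⨾ ((R ⊗ id) ⊗ id) ⨾ (((id ⊗ R) ⊗ id) ⨾ capˡ Y X)      ≡⟨ cong (_⨾ (((id ⊗ R) ⊗ id) ⨾ capˡ Y X)) (cupʳ-nat R) ⟩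
    R ⨾ cupʳ Y X ⨾ (((id ⊗ R) ⊗ id) ⨾ capˡ Y X)                     ≡⟨ trans assoc (cong (R ⨾_) (trans sym-assoc (sym (ᵒᵖ-unfold R)))) ⟩
    R ⨾ (R ᵒᵖ)                                                      ∎
    where
    capˡ≤ : capˡ X X ≤ ((R ⊗ id) ⊗ id) ⨾ (((id ⊗ R) ⊗ id) ⨾ capˡ Y X)
    capˡ≤ = begin
      (cap ⊗ id) ⨾ λ⇒                                       ≤⟨ ⨾-monoˡ-≤ (⊗-mono (total⇒cap≤⊗⨾cap t) ≤-refl) ⟩
      (((R ⊗ R) ⨾ cap) ⊗ id) ⨾ λ⇒                           ≡⟨ trans (cong (_⨾ λ⇒) (⨾-⊗id (R ⊗ R) cap)) assoc ⟩
      ((R ⊗ R) ⊗ id) ⨾ capˡ Y X                             ≡⟨ cong (_⨾ capˡ Y X) (trans (cong (_⊗ id) (⊗-split₁ R R)) (⨾-⊗id _ _)) ⟩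
      ((R ⊗ id) ⊗ id) ⨾ ((id ⊗ R) ⊗ id) ⨾ capˡ Y X           ≡⟨ assoc ⟩
      ((R ⊗ id) ⊗ id) ⨾ (((id ⊗ R) ⊗ id) ⨾ capˡ Y X)         ∎

  singleValued⇒ᵒᵖ⨾≤id : ∀ {X Y} {R : Hom X Y} → SingleValued R → (R ᵒᵖ) ⨾ R ≤ id
  singleValued⇒ᵒᵖ⨾≤id {X} {Y} {R} s = begin
    (R ᵒᵖ) ⨾ R                                           ≡⟨ cong (_⨾ R) (ᵒᵖ-unfold R) ⟩
    cupʳ Y X ⨾ ((id ⊗ R) ⊗ id) ⨾ capˡ Y X ⨾ R            ≡⟨ trans assoc (cong (cupʳ Y X ⨾ ((id ⊗ R) ⊗ id) ⨾_) (capˡ-nat R)) ⟩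
    cupʳ Y X ⨾ ((id ⊗ R) ⊗ id) ⨾ ((id ⊗ R) ⨾ capˡ Y Y)   ≡⟨ trans sym-assoc (cong (_⨾ capˡ Y Y) (trans assoc (cong (cupʳ Y X ⨾_) (sym (⊗-split₁ (id ⊗ R) R))))) ⟩
    cupʳ Y X ⨾ ((id ⊗ R) ⊗ R) ⨾ capˡ Y Y                 ≤⟨ ⨾-monoˡ-≤ cupʳ≤ ⟩
    cupʳ Y Y ⨾ capˡ Y Y                                  ≡⟨ snake ⟩
    id                                                   ∎
    where
    cupʳ≤ : cupʳ Y X ⨾ ((id ⊗ R) ⊗ R) ≤ cupʳ Y Y
    cupʳ≤ = begin
      ρ⇐ ⨾ (id ⊗ cup) ⨾ α⁻¹ ⨾ ((id ⊗ R) ⊗ R)       ≡⟨ trans assoc (cong (ρ⇐ ⨾ (id ⊗ cup) ⨾_) (α⁻¹-nat id R R)) ⟩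
      ρ⇐ ⨾ (id ⊗ cup) ⨾ ((id ⊗ (R ⊗ R)) ⨾ α⁻¹)    ≡⟨ trans sym-assoc (cong (_⨾ α⁻¹) assoc) ⟩
      ρ⇐ ⨾ ((id ⊗ cup) ⨾ (id ⊗ (R ⊗ R))) ⨾ α⁻¹    ≡⟨ cong (λ x → ρ⇐ ⨾ x ⨾ α⁻¹) (sym (id⊗-⨾ cup (R ⊗ R))) ⟩
      ρ⇐ ⨾ (id ⊗ (cup ⨾ (R ⊗ R))) ⨾ α⁻¹           ≤⟨ ⨾-monoˡ-≤ (⨾-monoʳ-≤ (⊗-mono ≤-refl (singleValued⇒cup⨾⊗≤cup s))) ⟩
      ρ⇐ ⨾ (id ⊗ cup) ⨾ α⁻¹                       ∎

  total≤singleValued⇒≡ : ∀ {X Y} {R S : Hom X Y} → R ≤ S → Total R → SingleValued S → R ≡ S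
  total≤singleValued⇒≡ {R = R} {S} p t s = ≤-antisym p (begin
    S                   ≡⟨ idˡ S ⟨
    id ⨾ S              ≤⟨ ⨾-monoˡ-≤ (total⇒id≤⨾ᵒᵖ t) ⟩
    R ⨾ (R ᵒᵖ) ⨾ S      ≤⟨ ⨾-monoˡ-≤ (⨾-monoʳ-≤ (ᵒᵖ-mono p)) ⟩
    R ⨾ (S ᵒᵖ) ⨾ S      ≡⟨ assoc ⟩
    R ⨾ ((S ᵒᵖ) ⨾ S)    ≤⟨ ⨾-monoʳ-≤ (singleValued⇒ᵒᵖ⨾≤id s) ⟩
    R ⨾ id              ≡⟨ idʳ R ⟩
    R                   ∎)

  -- Relates (k d , d) to d, and nothing else.
  π₂-onGraph : ∀ {C D} (k : Hom D C) → Hom (C ⊗₀ D) D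
  π₂-onGraph {C} {D} k = (id ⊗ δ) ⨾ α⁻¹ ⨾ ((id ⊗ k) ⊗ id) ⨾ capˡ C D

  π₂-onGraph-⨾ : ∀ {C D} {k : Hom D C} → SingleValued k → π₂-onGraph k ⨾ k ≡ (id ⊗ k) ⨾ δ*
  π₂-onGraph-⨾ {C} {D} {k} s = begin-equality
    (id ⊗ δ) ⨾ α⁻¹ ⨾ ((id ⊗ k) ⊗ id) ⨾ capˡ C D ⨾ k         ≡⟨ trans assoc (cong ((id ⊗ δ) ⨾ α⁻¹ ⨾ ((id ⊗ k) ⊗ id) ⨾_) (capˡ-nat k)) ⟩
    (id ⊗ δ) ⨾ α⁻¹ ⨾ ((id ⊗ k) ⊗ id) ⨾ ((id ⊗ k) ⨾ capˡ C C)
      ≡⟨ trans sym-assoc (cong (_⨾ capˡ C C) (trans assoc (cong ((id ⊗ δ) ⨾ α⁻¹ ⨾_) (sym (⊗-split₁ (id ⊗ k) k))))) ⟩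
    (id ⊗ δ) ⨾ α⁻¹ ⨾ ((id ⊗ k) ⊗ k) ⨾ capˡ C C              ≡⟨ cong (_⨾ capˡ C C) (trans assoc (cong ((id ⊗ δ) ⨾_) (α⁻¹-nat id k k))) ⟩
    (id ⊗ δ) ⨾ ((id ⊗ (k ⊗ k)) ⨾ α⁻¹) ⨾ capˡ C C            ≡⟨ cong (_⨾ capˡ C C) (trans sym-assoc (cong (_⨾ α⁻¹) (sym (id⊗-⨾ δ (k ⊗ k))))) ⟩
    (id ⊗ (δ ⨾ (k ⊗ k))) ⨾ α⁻¹ ⨾ capˡ C C                   ≡⟨ cong (λ x → (id ⊗ x) ⨾ α⁻¹ ⨾ capˡ C C) (singleValued⇒⨾δ≡δ⨾⊗ s) ⟨
    (id ⊗ (k ⨾ δ)) ⨾ α⁻¹ ⨾ capˡ C C                         ≡⟨ cong (λ x → x ⨾ α⁻¹ ⨾ capˡ C C) (id⊗-⨾ k δ) ⟩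
    (id ⊗ k) ⨾ (id ⊗ δ) ⨾ α⁻¹ ⨾ capˡ C C                    ≡⟨ trans (cong (_⨾ capˡ C C) assoc) assoc ⟩
    (id ⊗ k) ⨾ ((id ⊗ δ) ⨾ α⁻¹ ⨾ capˡ C C)                  ≡⟨ cong ((id ⊗ k) ⨾_) capˡ-frobenius ⟩
    (id ⊗ k) ⨾ δ*                                           ∎

  π₂-onGraph≤π₂ : ∀ {C D} (k : Hom D C) → π₂-onGraph k ≤ π₂
  π₂-onGraph≤π₂ k = begin
    (id ⊗ δ) ⨾ α⁻¹ ⨾ ((id ⊗ k) ⊗ id) ⨾ ((cap ⊗ id) ⨾ λ⇒)
      ≡⟨ trans sym-assoc (cong (_⨾ λ⇒) (trans assoc (cong ((id ⊗ δ) ⨾ α⁻¹ ⨾_) interchange))) ⟩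
    (id ⊗ δ) ⨾ α⁻¹ ⨾ (((id ⊗ k) ⨾ cap) ⊗ (id ⨾ id)) ⨾ λ⇒    ≤⟨ ⨾-monoˡ-≤ (⨾-monoʳ-≤ (⊗-mono graph-cap ≤-refl)) ⟩
    (id ⊗ δ) ⨾ α⁻¹ ⨾ (((ε ⊗ ε) ⨾ ρ⇒) ⊗ (id ⨾ id)) ⨾ λ⇒
      ≡⟨ cong (_⨾ λ⇒) (trans (cong ((id ⊗ δ) ⨾ α⁻¹ ⨾_) (⊗-⨾ _ _ _ _)) sym-assoc) ⟩
    (id ⊗ δ) ⨾ α⁻¹ ⨾ ((ε ⊗ ε) ⊗ id) ⨾ (ρ⇒ ⊗ id) ⨾ λ⇒
      ≡⟨ cong (λ x → x ⨾ (ρ⇒ ⊗ id) ⨾ λ⇒) (trans assoc (trans (cong ((id ⊗ δ) ⨾_) (α⁻¹-nat ε ε id)) sym-assoc)) ⟩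
    (id ⊗ δ) ⨾ (ε ⊗ (ε ⊗ id)) ⨾ α⁻¹ ⨾ (ρ⇒ ⊗ id) ⨾ λ⇒
      ≡⟨ cong (_⨾ λ⇒) (trans assoc (cong ((id ⊗ δ) ⨾ (ε ⊗ (ε ⊗ id)) ⨾_) α⁻¹⨾ρ⇒⊗id)) ⟩
    (id ⊗ δ) ⨾ (ε ⊗ (ε ⊗ id)) ⨾ (id ⊗ λ⇒) ⨾ λ⇒              ≡⟨ cong (_⨾ λ⇒) (trans (cong (_⨾ (id ⊗ λ⇒)) interchange) interchange) ⟩
    (((id ⨾ ε) ⨾ id) ⊗ (δ ⨾ (ε ⊗ id) ⨾ λ⇒)) ⨾ λ⇒            ≡⟨ cong (_⨾ λ⇒) (cong₂ _⊗_ (trans (idʳ _) (idˡ ε)) δ-counitˡ) ⟩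
    π₂                                                      ∎
    where
    graph-cap : (id ⊗ k) ⨾ cap ≤ (ε ⊗ ε) ⨾ ρ⇒
    graph-cap = begin
      (id ⊗ k) ⨾ cap                  ≤⟨ ⨾-monoʳ-≤ cap≤ε⊗ε ⟩
      (id ⊗ k) ⨾ ((ε ⊗ ε) ⨾ ρ⇒)       ≡⟨ trans sym-assoc (cong (_⨾ ρ⇒) interchange) ⟩
      ((id ⨾ ε) ⊗ (k ⨾ ε)) ⨾ ρ⇒       ≤⟨ ⨾-monoˡ-≤ (⊗-mono ≤-refl (ε-lax k)) ⟩
      ((id ⨾ ε) ⊗ ε) ⨾ ρ⇒             ≡⟨ cong (λ x → (x ⊗ ε) ⨾ ρ⇒) (idˡ ε) ⟩
      (ε ⊗ ε) ⨾ ρ⇒                    ∎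

  -- Relates a to d when d ∈ Y a and k d = g a.
  agreeing : ∀ {A C D} (g : Hom A C) (Y : Hom A D) (k : Hom D C) → Hom A D
  agreeing g Y k = δ ⨾ (g ⊗ Y) ⨾ π₂-onGraph k

  agreeing-⨾ : ∀ {A C D} {g : Hom A C} {Y : Hom A D} {k : Hom D C} →
               SingleValued k → agreeing g Y k ⨾ k ≡ g ∩ (Y ⨾ k)
  agreeing-⨾ {g = g} {Y} {k} s = begin-equality
    δ ⨾ (g ⊗ Y) ⨾ π₂-onGraph k ⨾ k          ≡⟨ trans assoc (cong (δ ⨾ (g ⊗ Y) ⨾_) (π₂-onGraph-⨾ s)) ⟩
    δ ⨾ (g ⊗ Y) ⨾ ((id ⊗ k) ⨾ δ*)           ≡⟨ trans sym-assoc (cong (_⨾ δ*) (trans assoc (cong (δ ⨾_) interchange))) ⟩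
    δ ⨾ ((g ⨾ id) ⊗ (Y ⨾ k)) ⨾ δ*           ≡⟨ cong (λ x → δ ⨾ (x ⊗ (Y ⨾ k)) ⨾ δ*) (idʳ g) ⟩
    g ∩ (Y ⨾ k)                             ∎

  agreeing≤ : ∀ {A C D} (g : Hom A C) (Y : Hom A D) (k : Hom D C) → agreeing g Y k ≤ Y
  agreeing≤ g Y k = begin
    δ ⨾ (g ⊗ Y) ⨾ π₂-onGraph k    ≤⟨ ⨾-monoʳ-≤ (π₂-onGraph≤π₂ k) ⟩
    δ ⨾ (g ⊗ Y) ⨾ π₂              ≡⟨ assoc ⟩
    δ ⨾ ((g ⊗ Y) ⨾ π₂)            ≤⟨ ⨾-monoʳ-≤ (π₂-lax g Y) ⟩
    δ ⨾ (π₂ ⨾ Y)                  ≡⟨ trans sym-assoc (cong (_⨾ Y) δ⨾π₂≡id) ⟩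
    id ⨾ Y                        ≡⟨ idˡ Y ⟩
    Y                             ∎

  agreeing⨾≤ : ∀ {A C D} {g : Hom A C} {Y : Hom A D} {k : Hom D C} →
               SingleValued k → agreeing g Y k ⨾ k ≤ g
  agreeing⨾≤ {g = g} {Y} {k} s = begin
    agreeing g Y k ⨾ k    ≡⟨ agreeing-⨾ s ⟩
    g ∩ (Y ⨾ k)           ≤⟨ ∩-lowerˡ g (Y ⨾ k) ⟩
    g                     ∎

  agreeing-total : ∀ {A C D} {g : Hom A C} {Y : Hom A D} {k : Hom D C} →
                   SingleValued k → Total k → Total g → g ≤ Y ⨾ k → Total (agreeing g Y k)
  agreeing-total {g = g} {Y} {k} k-sv k-total g-total g≤Y⨾k = begin
    ε                        ≤⟨ g-total ⟩
    g ⨾ ε                    ≤⟨ ⨾-monoˡ-≤ (≤-∩-self g) ⟩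
    g ∩ g ⨾ ε                ≤⟨ ⨾-monoˡ-≤ (∩-monoʳ g g≤Y⨾k) ⟩
    g ∩ (Y ⨾ k) ⨾ ε          ≡⟨ cong (_⨾ ε) (agreeing-⨾ k-sv) ⟨
    agreeing g Y k ⨾ k ⨾ ε   ≡⟨ trans assoc (cong (agreeing g Y k ⨾_) (total⇒⨾ε≡ε k-total)) ⟩
    agreeing g Y k ⨾ ε       ∎

  total⇒ᵒᵖ⨾≤⇒≤⨾ : ∀ {A B C} {f : Hom A B} {g : Hom A C} {S : Hom B C} →
                   Total f → (f ᵒᵖ) ⨾ g ≤ S → g ≤ f ⨾ S
  total⇒ᵒᵖ⨾≤⇒≤⨾ {f = f} {g} {S} t p = begin
    g                    ≡⟨ idˡ g ⟨
    id ⨾ g               ≤⟨ ⨾-monoˡ-≤ (total⇒id≤⨾ᵒᵖ t) ⟩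
    f ⨾ (f ᵒᵖ) ⨾ g       ≡⟨ assoc ⟩
    f ⨾ ((f ᵒᵖ) ⨾ g)     ≤⟨ ⨾-monoʳ-≤ p ⟩
    f ⨾ S                ∎

  ≤⨾ᵒᵖ⇒⨾≡ : ∀ {A B D} {ω : Hom A D} {f : Hom A B} {h : Hom D B} →
            Total ω → Total h → SingleValued h → SingleValued f → ω ≤ f ⨾ (h ᵒᵖ) → ω ⨾ h ≡ f
  ≤⨾ᵒᵖ⇒⨾≡ {ω = ω} {f} {h} ω-total h-total h-sv f-sv ω≤ =
    total≤singleValued⇒≡ ω⨾h≤f (⨾-total ω-total h-total) f-sv
    where
    ω⨾h≤f : ω ⨾ h ≤ f
    ω⨾h≤f = begin
      ω ⨾ h                ≤⟨ ⨾-monoˡ-≤ ω≤ ⟩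
      f ⨾ (h ᵒᵖ) ⨾ h       ≡⟨ assoc ⟩
      f ⨾ ((h ᵒᵖ) ⨾ h)     ≤⟨ ⨾-monoʳ-≤ (singleValued⇒ᵒᵖ⨾≤id h-sv) ⟩
      f ⨾ id               ≡⟨ idʳ f ⟩
      f                    ∎

  ≤agreeing⇒⨾≡ : ∀ {A C D} {ω : Hom A D} {g : Hom A C} {Y : Hom A D} {k : Hom D C} →
                 Total ω → Total k → SingleValued k → SingleValued g → ω ≤ agreeing g Y k → ω ⨾ k ≡ g
  ≤agreeing⇒⨾≡ ω-total k-total k-sv g-sv ω≤ =
    total≤singleValued⇒≡ (≤-trans (⨾-monoˡ-≤ ω≤) (agreeing⨾≤ k-sv)) (⨾-total ω-total k-total) g-sv

lemma5p2 : ∀ {o ℓ e : Level} (𝓑 : CartesianBicategory o ℓ e) →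
    let open CartesianBicategory 𝓑 in
    AxiomOfChoice →
    ∀ {A B C D : Obj} (f : Hom A B) (g : Hom A C) (h : Hom D B) (k : Hom D C) →
    IsMap f → IsMap g → IsMap h → IsMap k →
    ((f ᵒᵖ) ⨾ g) ≤ ((h ᵒᵖ) ⨾ k) →
    Σ (Hom A D) (λ ω → IsMap ω × (ω ⨾ h ≡ f) × (ω ⨾ k ≡ g))
lemma5p2 𝓑 choice {A} {D = D} f g h k (f-sv , f-total) (g-sv , g-total) (h-sv , h-total) (k-sv , k-total) fᵒᵖ⨾g≤hᵒᵖ⨾k =
  let (ω , ω-map@(_ , ω-total) , ω≤R) = choice R R-total in
  ω , ω-map ,
  ≤⨾ᵒᵖ⇒⨾≡ ω-total h-total h-sv f-sv (≤-trans ω≤R (agreeing≤ g (f ⨾ (h ᵒᵖ)) k)) ,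
  ≤agreeing⇒⨾≡ ω-total k-total k-sv g-sv ω≤R
  where
  open CartesianBicategory 𝓑
  open CartesianBicategoryProperties 𝓑

  R : Hom A D
  R = agreeing g (f ⨾ (h ᵒᵖ)) k

  R-total : Total R
  R-total = agreeing-total k-sv k-total g-total
              (≤-respʳ-≈ sym-assoc (total⇒ᵒᵖ⨾≤⇒≤⨾ f-total fᵒᵖ⨾g≤hᵒᵖ⨾k))
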